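{- Let $n,d,c,p,i$ be integers with $0\le d<n$, $1\le c\le p\le n-d$ and $0\le i\le d$, and let $\tau\in\bar{\mathcal{S}}_p(n,d)$. Suppose the $+$-component $\mathcal{C}^\tau_i$ has exactly $c$ elements and contains the $+$-subset $B=(b_1,\dots,b_d)$. Then: (a) for all $j\in[1,i]$, $b_j\le c+j-1$ and the $(\tau,B,j)$-series is left-aligned; (b) for all $j\in[i+1,d]$, $b_j\ge n-(c+d-j)+1$ and the $(\tau,B,j)$-series is right-aligned.
   Context: $[a,b]=\{x\in\mathbb{Z}:a\le x\le b\}$, $[n]=[1,n]$. A $d$-subset of $[n]$ is written as its increasing tuple $B=(b_1,\dots,b_d)$. For a function $f$ on $d$-subsets of $[n]$, a $d$-subset $B$ and $j\in[d]$, let $B_j=B\setminus\{b_j\}$ and $[n]\setminus B_j=\{x_1<\dots<x_{n-d+1}\}$; the $(f,B,j)$-series is $(f(B_j\cup\{x_1\}),\dots,f(B_j\cup\{x_{n-d+1}\}))$, and for $f$ the identity it is called the $(B,j)$-series. For $0\le d<n$, a $d$-co-signotope on $n$ elements is a map $\tau:\binom{[n]}{d}\to\{+,-\}$ such that every $(\tau,B,j)$-series has at most one sign change. A $+$-subset of $\tau$ is a $d$-subset $R$ with $\tau(R)=+$. $\bar{\mathcal{S}}_p(n,d)$ is the set of $d$-co-signotopes on $n$ elements with exactly $p$ $+$-subsets. A $(\tau,B,j)$-series is left-aligned if its first entry is $+$ and its last entry is $-$, and right-aligned if its first entry is $-$ and its last entry is $+$. The graph $G_{n,d}$ has the $d$-subsets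 of $[n]$ as vertices, two being adjacent if they are consecutive entries of some $(B,j)$-series. A $+$-component of $\tau$ is a connected component of the subgraph of $G_{n,d}$ induced by the $+$-subsets of $\tau$. For $i\in[0,d]$, $S_{n,d,i}=\{1,\dots,i\}\cup\{n-d+i+1,\dots,n\}$, and $\mathcal{C}^\tau_i$ denotes the $+$-component of $\tau$ containing $S_{n,d,i}$ (empty if $\tau(S_{n,d,i})=-$). -}

module Defs where

open import Data.Nat using (ℕ; zero; suc; _+_; _∸_; _≤_; _<_; _≤ᵇ_)
open import Data.Nat.Properties using (_≟_)
open import Data.Bool using (if_then_else_)
open import Data.List using (List; []; _∷_; _++_; map; filter; length; upTo; head; last)
open import Data.List.Relation.Unary.All using (All)
open import Data.List.Relation.Unary.Linked using (Linked)
open import Data.List.Relation.Unary.Unique.Propositional using (Unique)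
open import Data.List.Membership.Propositional using (_∈_)
open import Data.List.Membership.DecPropositional _≟_ using (_∈?_)
open import Data.Maybe using (just)
open import Data.Product using (Σ; _×_; ∃)
open import Data.Sum using (_⊎_)
open import Relation.Nullary using (¬?)
open import Relation.Binary.PropositionalEquality using (_≡_)
open import Function.Bundles using (_⇔_)

data Sign : Set where
  plus minus : Sign

range : ℕ → ℕ → List ℕ
range a b = map (a +_) (upTo (suc b ∸ a))

-- A d-subset of [n] is represented as its increasing tuple (b_1,...,b_d)
IsSub : ℕ → ℕ → List ℕ → Set
IsSub n d B = Linked _<_ B × All (λ x → 1 ≤ x × x ≤ n) B × length B ≡ d

-- b_j (1-indexed; default 0 out of range, never used in the statement)
at : List ℕ → ℕ → ℕ
at []       _             = 0
at (x ∷ xs) zero          = 0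
at (x ∷ xs) (suc zero)    = x
at (x ∷ xs) (suc (suc k)) = at xs (suc k)

-- B_j = B \ {b_j}  (1-indexed)
removeAt : List ℕ → ℕ → List ℕ
removeAt []       _             = []
removeAt (x ∷ xs) zero          = x ∷ xs
removeAt (x ∷ xs) (suc zero)    = xs
removeAt (x ∷ xs) (suc (suc k)) = x ∷ removeAt xs (suc k)

insert : ℕ → List ℕ → List ℕ
insert x []       = x ∷ []
insert x (y ∷ ys) = if x ≤ᵇ y then x ∷ y ∷ ys else y ∷ insert x ys

-- the (B,j)-series: (B_j ∪ {x_1}, ..., B_j ∪ {x_{n-d+1}}),
-- where [n] \ B_j = {x_1 < ... < x_{n-d+1}}
setSeries : ℕ → List ℕ → ℕ → List (List ℕ)
setSeries n B j =
  map (λ x → insert x (removeAt B j))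
      (filter (λ x → ¬? (x ∈? removeAt B j)) (range 1 n))

series : ℕ → (List ℕ → Sign) → List ℕ → ℕ → List Sign
series n τ B j = map τ (setSeries n B j)

changes : List Sign → ℕ
changes (plus  ∷ plus  ∷ r) = changes (plus ∷ r)
changes (minus ∷ minus ∷ r) = changes (minus ∷ r)
changes (plus  ∷ minus ∷ r) = suc (changes (minus ∷ r))
changes (minus ∷ plus  ∷ r) = suc (changes (plus ∷ r))
changes _                   = 0

-- d-co-signotope on n elements (τ is only ever evaluated on d-subsets of [n])
CoSignotope : ℕ → ℕ → (List ℕ → Sign) → Set
CoSignotope n d τ =
  ∀ B → IsSub n d B → ∀ j → 1 ≤ j → j ≤ d → changes (series n τ B j) ≤ 1

LeftAligned : List Sign → Set
LeftAligned s = head s ≡ just plus × last s ≡ just minus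

RightAligned : List Sign → Set
RightAligned s = head s ≡ just minus × last s ≡ just plus

HasSize : (List ℕ → Set) → ℕ → Set
HasSize P k = Σ (List (List ℕ)) λ L → Unique L × length L ≡ k × (∀ R → (R ∈ L) ⇔ P R)

InSbar : ℕ → ℕ → ℕ → (List ℕ → Sign) → Set
InSbar p n d τ = CoSignotope n d τ × HasSize (λ R → IsSub n d R × τ R ≡ plus) p

Consecutive : {A : Set} → A → A → List A → Set
Consecutive {A} x y s = Σ (List A) λ pre → Σ (List A) λ suf → s ≡ pre ++ (x ∷ y ∷ suf)

Adj : ℕ → ℕ → List ℕ → List ℕ → Set
Adj n d S T = Σ (List ℕ) λ B → Σ ℕ λ j →
  IsSub n d B × 1 ≤ j × j ≤ d ×
  (Consecutive S T (setSeries n B j) ⊎ Consecutive T S (setSeries n B j))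

data Reach (n d : ℕ) (τ : List ℕ → Sign) (S : List ℕ) : List ℕ → Set where
  here : IsSub n d S → τ S ≡ plus → Reach n d τ S S
  step : ∀ {T U} → Reach n d τ S T → Adj n d T U → IsSub n d U → τ U ≡ plus →
         Reach n d τ S U

Sndi : ℕ → ℕ → ℕ → List ℕ
Sndi n d i = range 1 i ++ range (n ∸ d + i + 1) n

InC : ℕ → ℕ → (List ℕ → Sign) → ℕ → List ℕ → Set
InC n d τ i R = Reach n d τ (Sndi n d i) R

-- Write d = k + 1. The row of a k-subset D of [n] is the list of the sets D ∪ {x}, x ∉ D, by increasing x, so
-- the (B, j)-series is the row of B_j. A row has n − k entries, more than the p ≤ n − d +-subsets of τ, and its
-- signs change at most once; hence a row with a + entry either starts with + or ends with +, but not both.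
-- The heart of the proof is the invariant that for every R in C^τ_i and every j, the (τ, R, j)-series starts
-- with + iff j ≤ i. It holds at S_{n,d,i}, since 1, …, r − 1 ∈ S_{n,d,i} for r ≤ i and r + 1, …, n ∈ S_{n,d,i}
-- for r > n − d + i. It survives a step A ∪ {x} — A ∪ {y} of G_{n,d}: otherwise there are two rows, of D and D′,
-- with opposite alignments and a common + entry v (D ∪ {v} and D′ ∪ {v} both +), and gluing the part of the first
-- row up to v to the part of the second from v on gives n − k distinct +-subsets.
-- Given the invariant, for j ≤ i every entry of the (τ, B, j)-series before B is + and adjacent to the next one,
-- so these b_j − j entries all lie in C^τ_i together with B, whence b_j ≤ c + j − 1; the case j > i is symmetric.

module Submission where

open import Defs
open import Data.Bool using (true; false)
open import Data.Empty using (⊥; ⊥-elim)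
open import Data.List using (List; []; _∷_; _++_; map; filter; length; upTo; head; last)
import Data.List.Properties as List
open import Data.List.Membership.Propositional using (_∈_; _∉_)
open import Data.List.Membership.Propositional.Properties
  using (∈-map⁺; ∈-map⁻; ∈-filter⁺; ∈-filter⁻; ∈-++⁺ˡ; ∈-++⁺ʳ; ∈-++⁻; ∈-∃++; ∈-upTo⁺; ∈-upTo⁻)
open import Data.List.Relation.Binary.Permutation.Propositional
  using (_↭_; ↭-refl; ↭-prep; ↭-swap; ↭-trans; ↭-sym)
open import Data.List.Relation.Binary.Permutation.Propositional.Properties
  using (∈-resp-↭; All-resp-↭; ↭-length; filter-↭)
open import Data.List.Relation.Unary.All as All using (All; []; _∷_)
import Data.List.Relation.Unary.All.Properties as All
open import Data.List.Relation.Unary.AllPairs as AllPairs using ([]; _∷_)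
open import Data.List.Relation.Unary.Any using (here; there)
open import Data.List.Relation.Unary.Linked using (Linked; []; [-]; _∷_)
open import Data.List.Relation.Unary.Linked.Properties as Linked using (Linked⇒All; Linked⇒AllPairs)
open import Data.List.Relation.Unary.Unique.Propositional using (Unique)
import Data.List.Relation.Unary.Unique.Propositional.Properties as Unique
open import Data.Maybe using (just)
open import Data.Nat using (ℕ; zero; suc; _+_; _∸_; _≤_; _<_; _≤ᵇ_; _<?_; _≤?_; z≤n; s≤s; s≤s⁻¹; >-nonZero)
open import Data.Nat.Properties
open import Data.List.Membership.DecPropositional _≟_ using (_∈?_)
open import Data.Product using (∃-syntax; _×_; _,_; proj₁; proj₂; uncurry)
open import Data.Sum as Sum using (_⊎_; inj₁; inj₂; [_,_]′)
open import Function using (_∘_)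
open import Function.Bundles using (_⇔_; mk⇔; Equivalence)
open import Function.Construct.Composition using (_⇔-∘_)
open import Function.Construct.Identity using (⇔-id)
open import Function.Construct.Symmetry using (⇔-sym)
open import Level using (0ℓ)
open import Relation.Binary.PropositionalEquality
  using (_≡_; _≢_; refl; sym; trans; cong; cong₂; subst; subst₂; module ≡-Reasoning)
open import Relation.Nullary using (¬_; Dec; yes; no; ¬?; contradiction)
open import Relation.Nullary.Reflects using (ofʸ; ofⁿ)
open import Relation.Unary using (Pred; Decidable)

module _ {A : Set} where

  unique-⊆⇒length≤ : ∀ {xs ys : List A} → Unique xs → (∀ {v} → v ∈ xs → v ∈ ys) →
                      length xs ≤ length ys
  unique-⊆⇒length≤ {[]} _ _ = z≤n
  unique-⊆⇒length≤ {x ∷ xs} (x∉xs ∷ u) xs⊆ys with ys₁ , ys₂ , refl ← ∈-∃++ (xs⊆ys (here refl)) =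
    subst (suc (length xs) ≤_) (sym (List.length-++-sucʳ ys₁ x ys₂)) (s≤s (unique-⊆⇒length≤ u avoid-x))
    where
    avoid-x : ∀ {v} → v ∈ xs → v ∈ ys₁ ++ ys₂
    avoid-x {v} v∈xs with ∈-++⁻ ys₁ (xs⊆ys (there v∈xs))
    ... | inj₁ v∈ys₁        = ∈-++⁺ˡ v∈ys₁
    ... | inj₂ (here v≡x)   = contradiction (sym v≡x) (All.lookup x∉xs v∈xs)
    ... | inj₂ (there v∈ys₂) = ∈-++⁺ʳ ys₁ v∈ys₂

  unique-cover⇒length≤ : ∀ {xs ys zs : List A} → Unique xs → (∀ {v} → v ∈ xs → v ∈ ys ⊎ v ∈ zs) →
                         length xs ≤ length ys + length zs
  unique-cover⇒length≤ {ys = ys} u cover =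
    subst (_ ≤_) (List.length-++ ys) (unique-⊆⇒length≤ u λ v∈xs → [ ∈-++⁺ˡ , ∈-++⁺ʳ ys ]′ (cover v∈xs))

  length-filter+filter-∁ : ∀ {P : Pred A 0ℓ} (P? : Decidable P) xs →
                           length (filter P? xs) + length (filter (¬? ∘ P?) xs) ≡ length xs
  length-filter+filter-∁ P? [] = refl
  length-filter+filter-∁ P? (x ∷ xs) with P? x
  ... | yes _ = cong suc (length-filter+filter-∁ P? xs)
  ... | no  _ = trans (+-suc _ _) (cong suc (length-filter+filter-∁ P? xs))

  map-unique-on : ∀ {B : Set} (f : A → B) {xs} → (∀ {x y} → x ∈ xs → y ∈ xs → f x ≡ f y → x ≡ y) →
                  Unique xs → Unique (map f xs)
  map-unique-on f {[]} _ [] = []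
  map-unique-on f {x ∷ xs} inj (x∉xs ∷ u) =
    All.map⁺ (All.tabulate fx≢) ∷ map-unique-on f (λ p q → inj (there p) (there q)) u
    where
    fx≢ : ∀ {y} → y ∈ xs → f x ≢ f y
    fx≢ y∈xs e = All.lookup x∉xs y∈xs (inj (here refl) (there y∈xs) e)

no-member⇒[] : ∀ {A : Set} {xs : List A} → (∀ {x} → x ∈ xs → ⊥) → xs ≡ []
no-member⇒[] {xs = []}    _        = refl
no-member⇒[] {xs = _ ∷ _} no-member = contradiction (here refl) no-member

HasSize-bound : ∀ {P c M} → HasSize P c → Unique M → (∀ {R} → R ∈ M → P R) → length M ≤ c
HasSize-bound (_ , _ , refl , ∈L⇔) u all-P =
  unique-⊆⇒length≤ u (λ R∈M → Equivalence.from (∈L⇔ _) (all-P R∈M))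

module _ {A : Set} {R : A → A → Set} where

  consecutive⇒linked : ∀ s → (∀ pre {x y} suf → s ≡ pre ++ x ∷ y ∷ suf → R x y) → Linked R s
  consecutive⇒linked []          _    = []
  consecutive⇒linked (x ∷ [])    _    = [-]
  consecutive⇒linked (x ∷ y ∷ s) R-at =
    R-at [] s refl ∷ consecutive⇒linked (y ∷ s) (λ pre suf eq → R-at (x ∷ pre) suf (cong (x ∷_) eq))

  linked-suffix : ∀ pre {s} → Linked R (pre ++ s) → Linked R s
  linked-suffix []            l       = l
  linked-suffix (_ ∷ [])      [-]     = []
  linked-suffix (_ ∷ [])      (_ ∷ l) = l
  linked-suffix (_ ∷ p ∷ pre) (_ ∷ l) = linked-suffix (p ∷ pre) l

  module _ {P Q : A → Set} where

    spread-right : (∀ {x y} → R x y → P x → Q y → P y) →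
      ∀ {x} rest → Linked R (x ∷ rest) → P x → All Q rest → All P rest
    spread-right extend []       _       _  []         = []
    spread-right extend (_ ∷ rest) (r ∷ l) px (qy ∷ qs) = py ∷ spread-right extend rest l py qs
      where py = extend r px qy

    spread-left : (∀ {x y} → R x y → P y → Q x → P x) →
      ∀ pre {x rest} → Linked R (pre ++ x ∷ rest) → P x → All Q pre → All P pre
    spread-left extend []            _       _  []         = []
    spread-left extend (_ ∷ [])      (r ∷ _) px (qy ∷ [])  = extend r px qy ∷ []
    spread-left extend (_ ∷ p ∷ pre) (r ∷ l) px (qy ∷ qs) with spread-left extend (p ∷ pre) l px qs
    ... | ps@(pp ∷ _) = extend r pp qy ∷ ps

-- Strictly increasing lists, insertion and removal

Increasing : List ℕ → Set
Increasing = Linked _<_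

increasing-tail : ∀ {x xs} → Increasing (x ∷ xs) → Increasing xs
increasing-tail [-]     = []
increasing-tail (_ ∷ l) = l

increasing⇒head< : ∀ {x xs} → Increasing (x ∷ xs) → All (x <_) xs
increasing⇒head< [-]         = []
increasing⇒head< (x<y ∷ l) = Linked⇒All <-trans x<y l

head<⇒increasing : ∀ {x xs} → All (x <_) xs → Increasing xs → Increasing (x ∷ xs)
head<⇒increasing []          []  = [-]
head<⇒increasing (x<y ∷ _) l = x<y ∷ l

increasing⇒unique : ∀ {xs} → Increasing xs → Unique xs
increasing⇒unique l = AllPairs.map <⇒≢ (Linked⇒AllPairs <-trans l)

increasing-split : ∀ {xs z} → Increasing xs → z ∈ xs →
  ∃[ ys ] ∃[ zs ] xs ≡ ys ++ z ∷ zs × All (_< z) ys × All (z <_) zs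
increasing-split l z∈xs with ys , zs , refl ← ∈-∃++ z∈xs = ys , zs , refl , around ys l
  where
  around : ∀ {z zs} ys → Increasing (ys ++ z ∷ zs) → All (_< z) ys × All (z <_) zs
  around []       l = [] , increasing⇒head< l
  around (y ∷ ys) l with ys<z , z<zs ← around ys (increasing-tail l) =
    All.lookup (increasing⇒head< l) (∈-++⁺ʳ ys (here refl)) ∷ ys<z , z<zs

increasing-ext : ∀ {xs ys} → Increasing xs → Increasing ys →
  (∀ {v} → v ∈ xs → v ∈ ys) → (∀ {v} → v ∈ ys → v ∈ xs) → xs ≡ ys
increasing-ext {[]}     {[]}     _  _  _    _    = refl
increasing-ext {[]}     {y ∷ ys} _  _  _    ys⊆ with () ← ys⊆ (here refl)
increasing-ext {x ∷ xs} {[]}     _  _  xs⊆ _    with () ← xs⊆ (here refl)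
increasing-ext {x ∷ xs} {y ∷ ys} lx ly xs⊆ ys⊆ =
  cong₂ _∷_ x≡y
    (increasing-ext (increasing-tail lx) (increasing-tail ly) (tail⊆ lx x≡y xs⊆) (tail⊆ ly (sym x≡y) ys⊆))
  where
  ≤-head : ∀ {x y ys} → Increasing (y ∷ ys) → x ∈ y ∷ ys → y ≤ x
  ≤-head _ (here refl)  = ≤-refl
  ≤-head l (there x∈ys) = <⇒≤ (All.lookup (increasing⇒head< l) x∈ys)
  x≡y : x ≡ y
  x≡y = ≤-antisym (≤-head lx (ys⊆ (here refl))) (≤-head ly (xs⊆ (here refl)))
  tail⊆ : ∀ {x y xs ys} → Increasing (x ∷ xs) → x ≡ y → (∀ {v} → v ∈ x ∷ xs → v ∈ y ∷ ys) →
          ∀ {v} → v ∈ xs → v ∈ ys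
  tail⊆ l refl ⊆ v∈xs with ⊆ (there v∈xs)
  ... | here refl = contradiction (All.lookup (increasing⇒head< l) v∈xs) (<-irrefl refl)
  ... | there v∈ys = v∈ys

insert-↭ : ∀ x ys → insert x ys ↭ x ∷ ys
insert-↭ x []       = ↭-refl
insert-↭ x (y ∷ ys) with x ≤ᵇ y
... | true  = ↭-refl
... | false = ↭-trans (↭-prep y (insert-↭ x ys)) (↭-swap y x ↭-refl)

∈-insert⁻ : ∀ {v} x ys → v ∈ insert x ys → v ≡ x ⊎ v ∈ ys
∈-insert⁻ x ys v∈ with ∈-resp-↭ (insert-↭ x ys) v∈
... | here v≡x   = inj₁ v≡x
... | there v∈ys = inj₂ v∈ys

∈-insert⁺ˡ : ∀ x ys → x ∈ insert x ys
∈-insert⁺ˡ x ys = ∈-resp-↭ (↭-sym (insert-↭ x ys)) (here refl)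

∈-insert⁺ʳ : ∀ {v} x {ys} → v ∈ ys → v ∈ insert x ys
∈-insert⁺ʳ x {ys} v∈ys = ∈-resp-↭ (↭-sym (insert-↭ x ys)) (there v∈ys)

∉-insert : ∀ {v x ys} → v ≢ x → v ∉ ys → v ∉ insert x ys
∉-insert {x = x} {ys} v≢x v∉ys v∈ with ∈-insert⁻ x ys v∈
... | inj₁ v≡x  = v≢x v≡x
... | inj₂ v∈ys = v∉ys v∈ys

All-insert : ∀ {P : Pred ℕ 0ℓ} {x ys} → P x → All P ys → All P (insert x ys)
All-insert {x = x} {ys} px pys = All-resp-↭ (↭-sym (insert-↭ x ys)) (px ∷ pys)

length-insert : ∀ x ys → length (insert x ys) ≡ suc (length ys)
length-insert x ys = ↭-length (insert-↭ x ys)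

insert-injective : ∀ {x y D} → x ∉ D → insert x D ≡ insert y D → x ≡ y
insert-injective {x} {y} {D} x∉D eq with ∈-insert⁻ y D (subst (x ∈_) eq (∈-insert⁺ˡ x D))
... | inj₁ x≡y  = x≡y
... | inj₂ x∈D = contradiction x∈D x∉D

insert-increasing : ∀ {x ys} → Increasing ys → x ∉ ys → Increasing (insert x ys)
insert-increasing {x} {[]}     _ _ = [-]
insert-increasing {x} {y ∷ ys} l x∉ with x ≤ᵇ y | ≤ᵇ-reflects-≤ x y
... | true  | ofʸ x≤y = ≤∧≢⇒< x≤y (x∉ ∘ here) ∷ l
... | false | ofⁿ x≰y =
  head<⇒increasing (All-insert (≰⇒> x≰y) (increasing⇒head< l))
                   (insert-increasing (increasing-tail l) (x∉ ∘ there))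

infixl 6 _∖_
_∖_ : List ℕ → ℕ → List ℕ
A ∖ a = filter (λ v → ¬? (v ≟ a)) A

∈-∖⁻ : ∀ {v} A a → v ∈ A ∖ a → v ∈ A × v ≢ a
∈-∖⁻ A a = ∈-filter⁻ (λ v → ¬? (v ≟ a))

∈-∖⁺ : ∀ {v A} a → v ∈ A → v ≢ a → v ∈ A ∖ a
∈-∖⁺ a = ∈-filter⁺ (λ v → ¬? (v ≟ a))

∉-∖ : ∀ A a → a ∉ A ∖ a
∉-∖ A a a∈ = proj₂ (∈-∖⁻ A a a∈) refl

∖-increasing : ∀ {A} a → Increasing A → Increasing (A ∖ a)
∖-increasing a = Linked.filter⁺ (λ v → ¬? (v ≟ a)) <-trans

All-∖ : ∀ {P : Pred ℕ 0ℓ} {A} a → All P A → All P (A ∖ a)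
All-∖ a = All.filter⁺ (λ v → ¬? (v ≟ a))

insert-∖ : ∀ {A a} → Increasing A → a ∈ A → insert a (A ∖ a) ≡ A
insert-∖ {A} {a} l a∈A =
  increasing-ext (insert-increasing (∖-increasing a l) (∉-∖ A a)) l to from
  where
  to : ∀ {v} → v ∈ insert a (A ∖ a) → v ∈ A
  to v∈ with ∈-insert⁻ a (A ∖ a) v∈
  ... | inj₁ refl = a∈A
  ... | inj₂ v∈A∖a = proj₁ (∈-∖⁻ A a v∈A∖a)
  from : ∀ {v} → v ∈ A → v ∈ insert a (A ∖ a)
  from {v} v∈A with v ≟ a
  ... | yes refl = ∈-insert⁺ˡ a (A ∖ a)
  ... | no v≢a   = ∈-insert⁺ʳ a (∈-∖⁺ a v∈A v≢a)

insert-∖-self : ∀ {A x} → Increasing A → x ∉ A → insert x A ∖ x ≡ A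
insert-∖-self {A} {x} l x∉A = increasing-ext (∖-increasing x (insert-increasing l x∉A)) l to from
  where
  to : ∀ {v} → v ∈ insert x A ∖ x → v ∈ A
  to v∈ with v∈′ , v≢x ← ∈-∖⁻ (insert x A) x v∈ with ∈-insert⁻ x A v∈′
  ... | inj₁ v≡x = contradiction v≡x v≢x
  ... | inj₂ v∈A = v∈A
  from : ∀ {v} → v ∈ A → v ∈ insert x A ∖ x
  from v∈A = ∈-∖⁺ x (∈-insert⁺ʳ x v∈A) (λ { refl → x∉A v∈A })

_[_↦_] : List ℕ → ℕ → ℕ → List ℕ
A [ a ↦ x ] = insert x (A ∖ a)

∖-insert : ∀ {A x a} → Increasing A → x ∉ A → a ≢ x → insert x A ∖ a ≡ A [ a ↦ x ]
∖-insert {A} {x} {a} l x∉A a≢x =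
  increasing-ext (∖-increasing a (insert-increasing l x∉A))
                 (insert-increasing (∖-increasing a l) (x∉A ∘ proj₁ ∘ ∈-∖⁻ A a)) to from
  where
  to : ∀ {v} → v ∈ insert x A ∖ a → v ∈ insert x (A ∖ a)
  to v∈ with v∈′ , v≢a ← ∈-∖⁻ (insert x A) a v∈ with ∈-insert⁻ x A v∈′
  ... | inj₁ refl = ∈-insert⁺ˡ x (A ∖ a)
  ... | inj₂ v∈A  = ∈-insert⁺ʳ x (∈-∖⁺ a v∈A v≢a)
  from : ∀ {v} → v ∈ insert x (A ∖ a) → v ∈ insert x A ∖ a
  from v∈ with ∈-insert⁻ x (A ∖ a) v∈
  ... | inj₁ refl = ∈-∖⁺ a (∈-insert⁺ˡ x A) (a≢x ∘ sym)
  ... | inj₂ v∈A∖a with v∈A , v≢a ← ∈-∖⁻ A a v∈A∖a = ∈-∖⁺ a (∈-insert⁺ʳ x v∈A) v≢a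

length-∖ : ∀ {A a} → Increasing A → a ∈ A → suc (length (A ∖ a)) ≡ length A
length-∖ {A} {a} l a∈A = trans (sym (length-insert a (A ∖ a))) (cong length (insert-∖ l a∈A))

∈-↦⁻ : ∀ {z} A a x → z ∈ A [ a ↦ x ] → z ≡ x ⊎ (z ∈ A × z ≢ a)
∈-↦⁻ A a x z∈ with ∈-insert⁻ x (A ∖ a) z∈
... | inj₁ z≡x  = inj₁ z≡x
... | inj₂ z∈A∖a = inj₂ (∈-∖⁻ A a z∈A∖a)

∈-↦⁺ : ∀ {z A a} x → z ∈ A → z ≢ a → z ∈ A [ a ↦ x ]
∈-↦⁺ x z∈A z≢a = ∈-insert⁺ʳ x (∈-∖⁺ _ z∈A z≢a)

insert-↦ : ∀ {A a x} → Increasing A → a ∈ A → x ∉ A → a ≢ x → insert a (A [ a ↦ x ]) ≡ insert x A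
insert-↦ {A} {a} {x} l a∈A x∉A a≢x =
  trans (cong (insert a) (sym (∖-insert l x∉A a≢x)))
        (insert-∖ (insert-increasing l x∉A) (∈-insert⁺ʳ x a∈A))

-- Ranks and positions

rank : ℕ → List ℕ → ℕ
rank z xs = length (filter (_<? z) xs)

rank-∷-< : ∀ {y z} xs → y < z → rank z (y ∷ xs) ≡ suc (rank z xs)
rank-∷-< {z = z} _ y<z = cong length (List.filter-accept (_<? z) y<z)

rank-∷-≮ : ∀ {y z} xs → ¬ y < z → rank z (y ∷ xs) ≡ rank z xs
rank-∷-≮ {z = z} _ y≮z = cong length (List.filter-reject (_<? z) y≮z)

rank-insert : ∀ z x xs → rank z (insert x xs) ≡ rank z (x ∷ xs)
rank-insert z x xs = ↭-length (filter-↭ (_<? z) (insert-↭ x xs))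

rank-insert-self : ∀ x xs → rank x (insert x xs) ≡ rank x xs
rank-insert-self x xs = trans (rank-insert x x xs) (rank-∷-≮ xs (<-irrefl refl))

rank-∖-self : ∀ {A a} → Increasing A → a ∈ A → rank a (A ∖ a) ≡ rank a A
rank-∖-self {A} {a} l a∈A = begin
  rank a (A ∖ a)              ≡⟨ rank-∷-≮ (A ∖ a) (<-irrefl refl) ⟨
  rank a (a ∷ A ∖ a)          ≡⟨ rank-insert a a (A ∖ a) ⟨
  rank a (insert a (A ∖ a))   ≡⟨ cong (rank a) (insert-∖ l a∈A) ⟩
  rank a A                    ∎
  where open ≡-Reasoning

rank-mono : ∀ {x y} → x ≤ y → ∀ xs → rank x xs ≤ rank y xs
rank-mono x≤y []       = z≤n
rank-mono {x} {y} x≤y (v ∷ xs) with v <? x | v <? y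
... | yes v<x | yes v<y =
  subst₂ _≤_ (sym (rank-∷-< xs v<x)) (sym (rank-∷-< xs v<y)) (s≤s (rank-mono x≤y xs))
... | yes v<x | no v≮y  = contradiction (<-≤-trans v<x x≤y) v≮y
... | no v≮x  | yes v<y =
  subst₂ _≤_ (sym (rank-∷-≮ xs v≮x)) (sym (rank-∷-< xs v<y)) (m≤n⇒m≤1+n (rank-mono x≤y xs))
... | no v≮x  | no v≮y  =
  subst₂ _≤_ (sym (rank-∷-≮ xs v≮x)) (sym (rank-∷-≮ xs v≮y)) (rank-mono x≤y xs)

rank-≤-∷ : ∀ {z} v xs → rank z xs ≤ rank z (v ∷ xs)
rank-≤-∷ {z} v xs with v <? z
... | yes v<z = ≤-trans (n≤1+n _) (≤-reflexive (sym (rank-∷-< xs v<z)))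
... | no v≮z  = ≤-reflexive (sym (rank-∷-≮ xs v≮z))

rank-strict : ∀ {a x xs} → a ∈ xs → a < x → suc (rank a xs) ≤ rank x xs
rank-strict {a} {x} {_ ∷ xs} (here refl) a<x =
  subst₂ _≤_ (cong suc (sym (rank-∷-≮ xs (<-irrefl refl)))) (sym (rank-∷-< xs a<x))
         (s≤s (rank-mono (<⇒≤ a<x) xs))
rank-strict {a} {x} {v ∷ xs} (there a∈xs) a<x with v <? a
... | yes v<a = subst₂ _≤_ (cong suc (sym (rank-∷-< xs v<a))) (sym (rank-∷-< xs (<-trans v<a a<x)))
                       (s≤s (rank-strict a∈xs a<x))
... | no v≮a  = subst (λ r → suc r ≤ rank x (v ∷ xs)) (sym (rank-∷-≮ xs v≮a))
                      (≤-trans (rank-strict a∈xs a<x) (rank-≤-∷ v xs))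

at-∈ : ∀ {m} xs → m < length xs → at xs (suc m) ∈ xs
at-∈ {zero}  (x ∷ xs) _         = here refl
at-∈ {suc m} (x ∷ xs) (s≤s m<) = there (at-∈ xs m<)

∈⇒at : ∀ {z xs} → z ∈ xs → ∃[ m ] m < length xs × at xs (suc m) ≡ z
∈⇒at (here refl) = zero , s≤s z≤n , refl
∈⇒at (there z∈xs) with m , m< , eq ← ∈⇒at z∈xs = suc m , s≤s m< , eq

rank-at : ∀ {m xs} → Increasing xs → m < length xs → rank (at xs (suc m)) xs ≡ m
rank-at {zero} {x ∷ xs} l _ =
  trans (rank-∷-≮ xs (<-irrefl refl))
        (cong length (List.filter-none (_<? x) (All.map <⇒≯ (increasing⇒head< l))))
rank-at {suc m} {x ∷ xs} l (s≤s m<) =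
  trans (rank-∷-< xs (All.lookup (increasing⇒head< l) (at-∈ xs m<)))
        (cong suc (rank-at (increasing-tail l) m<))

removeAt-∖ : ∀ {m xs} → Increasing xs → m < length xs → removeAt xs (suc m) ≡ xs ∖ at xs (suc m)
removeAt-∖ {zero} {x ∷ xs} l _ = sym (begin
  (x ∷ xs) ∖ x  ≡⟨ List.filter-reject (λ v → ¬? (v ≟ x)) (λ x≢x → x≢x refl) ⟩
  xs ∖ x        ≡⟨ List.filter-all (λ v → ¬? (v ≟ x)) (All.map (λ x<v → <⇒≢ x<v ∘ sym) (increasing⇒head< l)) ⟩
  xs            ∎)
  where open ≡-Reasoning
removeAt-∖ {suc m} {x ∷ xs} l (s≤s m<) = begin
  x ∷ removeAt xs (suc m)   ≡⟨ cong (x ∷_) (removeAt-∖ (increasing-tail l) m<) ⟩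
  x ∷ xs ∖ b                ≡⟨ List.filter-accept (λ v → ¬? (v ≟ b)) x≢b ⟨
  (x ∷ xs) ∖ b              ∎
  where
  open ≡-Reasoning
  b = at xs (suc m)
  x≢b = <⇒≢ (All.lookup (increasing⇒head< l) (at-∈ xs m<))

rank-crossing : ∀ {x y i xs} → Increasing xs → rank x xs < i → i ≤ rank y xs →
  ∃[ a ] a ∈ xs × x ≤ a × a < y × suc (rank a xs) ≡ i
rank-crossing {x} {y} {suc m} {xs} l rx<i i≤ry = a , a∈xs , x≤a , a<y , cong suc rank-a
  where
  m<length : m < length xs
  m<length = <-≤-trans i≤ry (List.length-filter (_<? y) xs)
  a = at xs (suc m)
  a∈xs = at-∈ xs m<length
  rank-a = rank-at l m<length
  x≤a : x ≤ a
  x≤a = ≮⇒≥ λ a<x → <⇒≱ (subst (λ r → suc r ≤ rank x xs) rank-a (rank-strict a∈xs a<x)) (s≤s⁻¹ rx<i)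
  a<y : a < y
  a<y = ≰⇒> λ y≤a → <⇒≱ i≤ry (subst (rank y xs ≤_) rank-a (rank-mono y≤a xs))

∈-range⁺ : ∀ {a b x} → a ≤ x → x ≤ b → x ∈ range a b
∈-range⁺ {a} {b} a≤x x≤b =
  subst (_∈ range a b) (m+[n∸m]≡n a≤x) (∈-map⁺ (a +_) (∈-upTo⁺ (∸-monoˡ-< (s≤s x≤b) a≤x)))

∈-range⁻ : ∀ {a b x} → x ∈ range a b → a ≤ x × x ≤ b
∈-range⁻ {a} {b} x∈ with y , y∈ , refl ← ∈-map⁻ (a +_) x∈ = m≤m+n a y , s≤s⁻¹ a+y<1+b
  where
  y< : y < suc b ∸ a
  y< = ∈-upTo⁻ y∈
  a<1+b : a < suc b
  a<1+b = m∸n≢0⇒n<m λ eq → contradiction (subst (y <_) eq y<) λ ()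
  a+y<1+b : a + y < suc b
  a+y<1+b = subst (a + y <_) (m+[n∸m]≡n (<⇒≤ a<1+b)) (+-monoʳ-< a y<)

range-increasing : ∀ a b → Increasing (range a b)
range-increasing a b = Linked.map⁺ (Linked.applyUpTo⁺₂ (λ i → i) (suc b ∸ a) (λ i → +-monoʳ-< a (n<1+n i)))

length-range : ∀ a b → length (range a b) ≡ suc b ∸ a
length-range a b = trans (List.length-map (a +_) (upTo (suc b ∸ a))) (List.length-upTo (suc b ∸ a))

rank<self : ∀ {r xs} → Increasing xs → All (1 ≤_) xs → 1 ≤ r → rank r xs < r
rank<self {r} {xs} l 1≤xs 1≤r =
  subst (suc (rank r xs) ≤_) (length-range 1 r) (unique-⊆⇒length≤ unique ⊆range)
  where
  unique : Unique (r ∷ filter (_<? r) xs)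
  unique = All.tabulate (λ v∈ r≡v → <-irrefl (sym r≡v) (proj₂ (∈-filter⁻ (_<? r) {xs = xs} v∈)))
         ∷ Unique.filter⁺ (_<? r) (increasing⇒unique l)
  ⊆range : ∀ {v} → v ∈ r ∷ filter (_<? r) xs → v ∈ range 1 r
  ⊆range (here refl) = ∈-range⁺ 1≤r ≤-refl
  ⊆range (there v∈′) with v∈xs , v<r ← ∈-filter⁻ (_<? r) {xs = xs} v∈′ =
    ∈-range⁺ (All.lookup 1≤xs v∈xs) (<⇒≤ v<r)

∈-Sndi⁻ : ∀ n d i {z} → z ∈ Sndi n d i → (1 ≤ z × z ≤ i) ⊎ (n ∸ d + i + 1 ≤ z × z ≤ n)
∈-Sndi⁻ n d i z∈ = Sum.map ∈-range⁻ ∈-range⁻ (∈-++⁻ (range 1 i) z∈)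

∈-Sndi⁺ˡ : ∀ n d {i z} → 1 ≤ z → z ≤ i → z ∈ Sndi n d i
∈-Sndi⁺ˡ n d 1≤z z≤i = ∈-++⁺ˡ (∈-range⁺ 1≤z z≤i)

∈-Sndi⁺ʳ : ∀ n d i {z} → n ∸ d + i + 1 ≤ z → z ≤ n → z ∈ Sndi n d i
∈-Sndi⁺ʳ n d i t≤z z≤top = ∈-++⁺ʳ (range 1 i) (∈-range⁺ t≤z z≤top)

m∸n+1≤o : ∀ {m n o} → 1 ≤ o → suc m ∸ o ≤ n → m ∸ n + 1 ≤ o
m∸n+1≤o {m} {n} {o} 1≤o bound =
  subst (_≤ o) (+-comm 1 (m ∸ n)) (m<n+o⇒m∸n<o m n {{>-nonZero 1≤o}} m<n+o)
  where
  open ≤-Reasoning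
  m<n+o : m < n + o
  m<n+o = begin-strict
    m               <⟨ n<1+n m ⟩
    suc m           ≤⟨ m≤n+m∸n (suc m) o ⟩
    o + (suc m ∸ o) ≤⟨ +-monoʳ-≤ o bound ⟩
    o + n           ≡⟨ +-comm o n ⟩
    n + o           ∎

suc<⇔< : ∀ {r i} → suc r ≢ i → suc r < i ⇔ r < i
suc<⇔< sr≢i = mk⇔ (<-trans (n<1+n _)) (λ r<i → ≤∧≢⇒< r<i sr≢i)

-- Sign sequences with at most one sign change

last-∷ : ∀ {A : Set} (a : A) s → ∃[ b ] last (a ∷ s) ≡ just b
last-∷ a []      = a , refl
last-∷ _ (b ∷ s) = last-∷ b s

no-change⇒constant : ∀ a s → changes (a ∷ s) ≡ 0 → All (_≡ a) s
no-change⇒constant a     []          _ = []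
no-change⇒constant plus  (plus ∷ s)  c = refl ∷ no-change⇒constant plus s c
no-change⇒constant minus (minus ∷ s) c = refl ∷ no-change⇒constant minus s c

last-constant : ∀ {A : Set} {a : A} s → All (_≡ a) s → last (a ∷ s) ≡ just a
last-constant []               []            = refl
last-constant (_ ∷ [])         (refl ∷ [])   = refl
last-constant (_ ∷ s@(_ ∷ _)) (refl ∷ s≡a) = last-constant s s≡a

equal-ends⇒constant : ∀ a s → changes (a ∷ s) ≤ 1 → last (a ∷ s) ≡ just a → All (_≡ a) s
equal-ends⇒constant a     []          _       _ = []
equal-ends⇒constant plus  (plus ∷ s)  c       l = refl ∷ equal-ends⇒constant plus s c l
equal-ends⇒constant minus (minus ∷ s) c       l = refl ∷ equal-ends⇒constant minus s c l
equal-ends⇒constant plus  (minus ∷ s) (s≤s c) l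
  with () ← trans (sym l) (last-constant s (no-change⇒constant minus s (n≤0⇒n≡0 c)))
equal-ends⇒constant minus (plus ∷ s)  (s≤s c) l
  with () ← trans (sym l) (last-constant s (no-change⇒constant plus s (n≤0⇒n≡0 c)))

changes-∷ : ∀ a s → changes s ≤ changes (a ∷ s)
changes-∷ _     []          = z≤n
changes-∷ plus  (plus ∷ s)  = ≤-refl
changes-∷ minus (minus ∷ s) = ≤-refl
changes-∷ plus  (minus ∷ s) = n≤1+n _
changes-∷ minus (plus ∷ s)  = n≤1+n _

changes-++ : ∀ pre s → changes s ≤ changes (pre ++ s)
changes-++ []        s = ≤-refl
changes-++ (a ∷ pre) s = ≤-trans (changes-++ pre s) (changes-∷ a (pre ++ s))

last-++ : ∀ {A : Set} (pre : List A) a s → last (pre ++ a ∷ s) ≡ last (a ∷ s)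
last-++ []              a s = refl
last-++ (_ ∷ [])        a s = refl
last-++ (_ ∷ pre@(_ ∷ _)) a s = last-++ pre a s

plus-before-plus : ∀ pre rest → head (pre ++ plus ∷ rest) ≡ just plus → changes (pre ++ plus ∷ rest) ≤ 1 →
  All (_≡ plus) pre
plus-before-plus []          rest _    _ = []
plus-before-plus (plus ∷ pre) rest refl c = refl ∷ go pre c
  where
  go : ∀ pre → changes (plus ∷ pre ++ plus ∷ rest) ≤ 1 → All (_≡ plus) pre
  go []            _       = []
  go (plus ∷ pre)  c       = refl ∷ go pre c
  go (minus ∷ pre) (s≤s c)
    with () ← All.lookup (no-change⇒constant minus (pre ++ plus ∷ rest) (n≤0⇒n≡0 c)) (∈-++⁺ʳ pre (here refl))

plus-after-plus : ∀ pre rest → last (pre ++ plus ∷ rest) ≡ just plus → changes (pre ++ plus ∷ rest) ≤ 1 →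
  All (_≡ plus) rest
plus-after-plus pre rest l c =
  equal-ends⇒constant plus rest (≤-trans (changes-++ pre (plus ∷ rest)) c) (trans (sym (last-++ pre plus rest)) l)

head-last-plus⇒all-plus : ∀ s → head s ≡ just plus → last s ≡ just plus → changes s ≤ 1 → All (_≡ plus) s
head-last-plus⇒all-plus (plus ∷ s) _ l c = refl ∷ equal-ends⇒constant plus s c l

plus⇒head⊎last : ∀ s → plus ∈ s → changes s ≤ 1 → head s ≡ just plus ⊎ last s ≡ just plus
plus⇒head⊎last (plus ∷ s) _ _ = inj₁ refl
plus⇒head⊎last (minus ∷ s) plus∈ c with last-∷ minus s
... | plus , eq  = inj₂ eq
... | minus , eq with () ← All.lookup (refl ∷ equal-ends⇒constant minus s c eq) plus∈

head-minus : ∀ s → plus ∈ s → head s ≢ just plus → head s ≡ just minus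
head-minus (plus ∷ _)  _ ¬+ = contradiction refl ¬+
head-minus (minus ∷ _) _ _  = refl

last-minus : ∀ s → plus ∈ s → last s ≢ just plus → last s ≡ just minus
last-minus (a ∷ s) _ ¬+ with last-∷ a s
... | plus , eq  = contradiction eq ¬+
... | minus , eq = eq

-- Subsets of [n] and their rows

at-IsSub : ∀ {n e B j} → IsSub n (suc e) B → 1 ≤ j → j ≤ suc e → at B j ∈ B × removeAt B j ≡ B ∖ at B j
at-IsSub {B = B} {suc m} (l , _ , len) _ j≤ = at-∈ B m< , removeAt-∖ l m<
  where
  m< : m < length B
  m< = subst (m <_) (sym len) j≤

∈⇒removeAt : ∀ {n e B z} → IsSub n (suc e) B → z ∈ B → ∃[ j ] 1 ≤ j × j ≤ suc e × removeAt B j ≡ B ∖ z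
∈⇒removeAt (l , _ , len) z∈B with m , m< , refl ← ∈⇒at z∈B =
  suc m , s≤s z≤n , subst (suc m ≤_) len m< , removeAt-∖ l m<

module Rows (n : ℕ) where

  -- setSeries n B j is, by definition, row (removeAt B j).

  complement : List ℕ → List ℕ
  complement D = filter (λ x → ¬? (x ∈? D)) (range 1 n)

  row : List ℕ → List (List ℕ)
  row D = map (λ x → insert x D) (complement D)

  ∈-complement⁺ : ∀ {x D} → x ∉ D → 1 ≤ x → x ≤ n → x ∈ complement D
  ∈-complement⁺ {D = D} x∉D 1≤x x≤n = ∈-filter⁺ (λ x → ¬? (x ∈? D)) (∈-range⁺ 1≤x x≤n) x∉D

  ∈-complement⁻ : ∀ {x D} → x ∈ complement D → x ∉ D × 1 ≤ x × x ≤ n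
  ∈-complement⁻ {D = D} x∈ with x∈range , x∉D ← ∈-filter⁻ (λ x → ¬? (x ∈? D)) {xs = range 1 n} x∈ =
    x∉D , ∈-range⁻ x∈range

  complement-increasing : ∀ D → Increasing (complement D)
  complement-increasing D = Linked.filter⁺ (λ x → ¬? (x ∈? D)) <-trans (range-increasing 1 n)

  length-complement : ∀ {e D} → IsSub n e D → n ≤ length (complement D) + e
  length-complement {e} {D} (_ , _ , refl) = subst (_≤ length (complement D) + e) (length-range 1 n)
    (unique-cover⇒length≤ (increasing⇒unique (range-increasing 1 n)) cover)
    where
    cover : ∀ {x} → x ∈ range 1 n → x ∈ complement D ⊎ x ∈ D
    cover {x} x∈ with x ∈? D
    ... | yes x∈D = inj₂ x∈D
    ... | no x∉D  = inj₁ (uncurry (∈-complement⁺ x∉D) (∈-range⁻ x∈))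

  row-unique : ∀ D → Unique (row D)
  row-unique D = map-unique-on (λ x → insert x D)
    (λ x∈ _ → insert-injective (proj₁ (∈-complement⁻ x∈))) (increasing⇒unique (complement-increasing D))

  ∈-complement-other : ∀ {x D E} → x ∈ complement D → x ∉ E → x ∈ complement E
  ∈-complement-other x∈ x∉E with _ , 1≤x , x≤n ← ∈-complement⁻ x∈ = ∈-complement⁺ x∉E 1≤x x≤n

  IsSub-insert : ∀ {e D x} → IsSub n e D → x ∈ complement D → IsSub n (suc e) (insert x D)
  IsSub-insert {D = D} {x} (l , in-range , refl) x∈ with x∉D , 1≤x , x≤n ← ∈-complement⁻ x∈ =
    insert-increasing l x∉D , All-insert (1≤x , x≤n) in-range , length-insert x D

  IsSub-∖ : ∀ {e A a} → IsSub n (suc e) A → a ∈ A → IsSub n e (A ∖ a)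
  IsSub-∖ {A = A} {a} (l , in-range , len) a∈A =
    ∖-increasing a l , All-∖ a in-range , suc-injective (trans (length-∖ l a∈A) len)

  IsSub-↦ : ∀ {e A a x} → IsSub n e A → a ∈ A → x ∈ complement A → IsSub n e (A [ a ↦ x ])
  IsSub-↦ {A = A} {a} {x} sA@(l , in-range , len) a∈A x∈ =
    insert-increasing (∖-increasing a l) (x∉A ∘ proj₁ ∘ ∈-∖⁻ A a) ,
    All-insert (proj₂ (∈-complement⁻ x∈)) (All-∖ a in-range) ,
    trans (length-insert x (A ∖ a)) (trans (length-∖ l a∈A) len)
    where
    x∉A = proj₁ (∈-complement⁻ x∈)

  ∈-complement-IsSub : ∀ {e A a E} → IsSub n e A → a ∈ A → a ∉ E → a ∈ complement E
  ∈-complement-IsSub (_ , in-range , _) a∈A a∉E =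
    uncurry (∈-complement⁺ a∉E) (All.lookup in-range a∈A)

  IsSub-row : ∀ {e D R} → IsSub n e D → R ∈ row D → IsSub n (suc e) R
  IsSub-row {D = D} sD R∈ with x , x∈ , refl ← ∈-map⁻ (λ x → insert x D) R∈ = IsSub-insert sD x∈

  consecutive-∈ : ∀ {S T} {s : List (List ℕ)} → Consecutive S T s → S ∈ s × T ∈ s
  consecutive-∈ (pre , _ , refl) = ∈-++⁺ʳ pre (here refl) , ∈-++⁺ʳ pre (there (here refl))

  Adj-sym : ∀ {d S T} → Adj n d S T → Adj n d T S
  Adj-sym (B , j , sB , 1≤j , j≤d , consecutive) = B , j , sB , 1≤j , j≤d , Sum.swap consecutive

  adjacent-rows : ∀ {e T U} → Adj n (suc e) T U →
    ∃[ D ] ∃[ x ] ∃[ y ] IsSub n e D × x ∈ complement D × y ∈ complement D × T ≡ insert x D × U ≡ insert y D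
  adjacent-rows {e} {T} {U} (B , j , sB , 1≤j , j≤ , consecutive) =
    let (x , x∈ , T≡) = ∈-map⁻ (λ x → insert x D) T∈
        (y , y∈ , U≡) = ∈-map⁻ (λ y → insert y D) U∈
    in D , x , y , sD , x∈ , y∈ , T≡ , U≡
    where
    D = removeAt B j
    sD : IsSub n e D
    sD with r∈B , removeAt≡ ← at-IsSub sB 1≤j j≤ = subst (IsSub n e) (sym removeAt≡) (IsSub-∖ sB r∈B)
    T∈ : T ∈ row D
    T∈ = [ proj₁ ∘ consecutive-∈ , proj₂ ∘ consecutive-∈ ]′ consecutive
    U∈ : U ∈ row D
    U∈ = [ proj₂ ∘ consecutive-∈ , proj₁ ∘ consecutive-∈ ]′ consecutive

  row-linked : ∀ {e R r} → IsSub n (suc e) R → r ∈ R → Linked (Adj n (suc e)) (row (R ∖ r))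
  row-linked {R = R} sR r∈R with j , 1≤j , j≤ , removeAt≡ ← ∈⇒removeAt sR r∈R =
    subst (λ D → Linked (Adj n _) (row D)) removeAt≡
      (consecutive⇒linked (row (removeAt R j)) λ pre suf eq → R , j , sR , 1≤j , j≤ , inj₁ (pre , suf , eq))

-- Rows of a co-signotope

-- k = d − 1 is the size of the sets whose rows are considered, and p + k < n says that a row is longer
-- than the number p of +-subsets.
module RowSigns (n k p : ℕ) (τ : List ℕ → Sign) (τ-cosignotope : CoSignotope n (suc k) τ)
  (plus-size : HasSize (λ R → IsSub n (suc k) R × τ R ≡ plus) p) (p+k<n : p + k < n) where

  open Rows n

  PlusSubset : List ℕ → Set
  PlusSubset R = IsSub n (suc k) R × τ R ≡ plus

  entry : List ℕ → ℕ → Sign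
  entry D x = τ (insert x D)

  signs : List ℕ → List Sign
  signs D = map τ (row D)

  StartsPlus EndsPlus : List ℕ → Set
  StartsPlus D = head (signs D) ≡ just plus
  EndsPlus   D = last (signs D) ≡ just plus

  signs-changes : ∀ {D z} → IsSub n k D → z ∈ complement D → changes (signs D) ≤ 1
  signs-changes {D} {z} sD z∈ with ∈⇒removeAt (IsSub-insert sD z∈) (∈-insert⁺ˡ z D)
  ... | j , 1≤j , j≤ , removeAt≡ =
    subst (λ E → changes (signs E) ≤ 1)
          (trans removeAt≡ (insert-∖-self (proj₁ sD) (proj₁ (∈-complement⁻ z∈))))
          (τ-cosignotope (insert z D) (IsSub-insert sD z∈) j 1≤j j≤)

  plus∈signs : ∀ {D z} → z ∈ complement D → entry D z ≡ plus → plus ∈ signs D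
  plus∈signs {D} z∈ z+ = subst (_∈ signs D) z+ (∈-map⁺ τ (∈-map⁺ (λ x → insert x D) z∈))

  too-many-plus : ∀ {M} → Unique M → (∀ {R} → R ∈ M → PlusSubset R) → n ≤ length M + k → ⊥
  too-many-plus u all+ n≤ = <⇒≱ p+k<n (≤-trans n≤ (+-monoˡ-≤ k (HasSize-bound plus-size u all+)))

  starts⊎ends : ∀ {D z} → IsSub n k D → z ∈ complement D → entry D z ≡ plus → StartsPlus D ⊎ EndsPlus D
  starts⊎ends sD z∈ z+ = plus⇒head⊎last _ (plus∈signs z∈ z+) (signs-changes sD z∈)

  ¬starts×ends : ∀ {D z} → IsSub n k D → z ∈ complement D → ¬ (StartsPlus D × EndsPlus D)
  ¬starts×ends {D} sD z∈ (starts , ends) = too-many-plus (row-unique D) all+ n≤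
    where
    all+ : ∀ {R} → R ∈ row D → PlusSubset R
    all+ R∈ = IsSub-row sD R∈ ,
      All.lookup (All.map⁻ (head-last-plus⇒all-plus (signs D) starts ends (signs-changes sD z∈))) R∈
    n≤ : n ≤ length (row D) + k
    n≤ = subst (λ m → n ≤ m + k) (sym (List.length-map _ (complement D))) (length-complement sD)

  ¬starts⇒ends : ∀ {D z} → IsSub n k D → z ∈ complement D → entry D z ≡ plus → ¬ StartsPlus D → EndsPlus D
  ¬starts⇒ends sD z∈ z+ ¬starts = Sum.fromInj₂ (λ starts → contradiction starts ¬starts) (starts⊎ends sD z∈ z+)

  ends⇒¬starts : ∀ {D z} → IsSub n k D → z ∈ complement D → EndsPlus D → ¬ StartsPlus D
  ends⇒¬starts sD z∈ ends starts = ¬starts×ends sD z∈ (starts , ends)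

  record Around (D : List ℕ) (z : ℕ) : Set where
    field
      left right  : List ℕ
      complement≡ : complement D ≡ left ++ z ∷ right
      left<z      : All (_< z) left
      z<right     : All (z <_) right
      signs≡      : signs D ≡ map (entry D) left ++ plus ∷ map (entry D) right
      left-plus   : StartsPlus D → All (λ x → entry D x ≡ plus) left
      right-plus  : EndsPlus D → All (λ x → entry D x ≡ plus) right

    left⊆ : ∀ {x} → x ∈ left → x ∈ complement D
    left⊆ x∈ = subst (_ ∈_) (sym complement≡) (∈-++⁺ˡ x∈)

    right⊆ : ∀ {x} → x ∈ right → x ∈ complement D
    right⊆ x∈ = subst (_ ∈_) (sym complement≡) (∈-++⁺ʳ left (there x∈))

    ∈-left : ∀ {x} → x ∈ complement D → x < z → x ∈ left
    ∈-left x∈ x<z with ∈-++⁻ left (subst (_ ∈_) complement≡ x∈)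
    ... | inj₁ x∈left          = x∈left
    ... | inj₂ (here refl)     = contradiction x<z (<-irrefl refl)
    ... | inj₂ (there x∈right) = contradiction x<z (<-asym (All.lookup z<right x∈right))

    ∈-right : ∀ {x} → x ∈ complement D → z < x → x ∈ right
    ∈-right x∈ z<x with ∈-++⁻ left (subst (_ ∈_) complement≡ x∈)
    ... | inj₁ x∈left          = contradiction z<x (<-asym (All.lookup left<z x∈left))
    ... | inj₂ (here refl)     = contradiction z<x (<-irrefl refl)
    ... | inj₂ (there x∈right) = x∈right

  around : ∀ {D z} → IsSub n k D → z ∈ complement D → entry D z ≡ plus → Around D z
  around {D} {z} sD z∈ z+ with increasing-split (complement-increasing D) z∈
  ... | C₁ , C₂ , complement≡ , C₁<z , z<C₂ = record
    { left = C₁ ; right = C₂ ; complement≡ = complement≡ ; left<z = C₁<z ; z<right = z<C₂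
    ; signs≡ = signs≡
    ; left-plus  = λ starts → All.map⁻ (plus-before-plus (map (entry D) C₁) (map (entry D) C₂)
                                 (subst (λ s → head s ≡ just plus) signs≡ starts) changes≤1)
    ; right-plus = λ ends → All.map⁻ (plus-after-plus (map (entry D) C₁) (map (entry D) C₂)
                                 (subst (λ s → last s ≡ just plus) signs≡ ends) changes≤1)
    }
    where
    signs≡ : signs D ≡ map (entry D) C₁ ++ plus ∷ map (entry D) C₂
    signs≡ = begin
      map τ (map (λ x → insert x D) (complement D))    ≡⟨ List.map-∘ (complement D) ⟨
      map (entry D) (complement D)                     ≡⟨ cong (map (entry D)) complement≡ ⟩
      map (entry D) (C₁ ++ z ∷ C₂)                     ≡⟨ List.map-++ (entry D) C₁ (z ∷ C₂) ⟩
      map (entry D) C₁ ++ entry D z ∷ map (entry D) C₂ ≡⟨ cong (λ σ → map (entry D) C₁ ++ σ ∷ map (entry D) C₂) z+ ⟩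
      map (entry D) C₁ ++ plus ∷ map (entry D) C₂      ∎
      where open ≡-Reasoning
    changes≤1 : changes (map (entry D) C₁ ++ plus ∷ map (entry D) C₂) ≤ 1
    changes≤1 = subst (λ s → changes s ≤ 1) signs≡ (signs-changes sD z∈)

  starts-extend : ∀ {D z x} → IsSub n k D → StartsPlus D → z ∈ complement D → entry D z ≡ plus →
                  x ∈ complement D → x ≤ z → entry D x ≡ plus
  starts-extend sD starts z∈ z+ x∈ x≤z with m≤n⇒m<n∨m≡n x≤z
  ... | inj₁ x<z  = All.lookup (left-plus starts) (∈-left x∈ x<z)
    where open Around (around sD z∈ z+)
  ... | inj₂ refl = z+

  ends-extend : ∀ {D z x} → IsSub n k D → EndsPlus D → z ∈ complement D → entry D z ≡ plus →
                x ∈ complement D → z ≤ x → entry D x ≡ plus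
  ends-extend sD ends z∈ z+ x∈ z≤x with m≤n⇒m<n∨m≡n z≤x
  ... | inj₁ z<x  = All.lookup (right-plus ends) (∈-right x∈ z<x)
    where open Around (around sD z∈ z+)
  ... | inj₂ refl = z+

  -- The glued list: D ∪ {z} for z ≤ v, and D′ ∪ {z} for z > v, except that D′ ∪ {v} stands in for D′ ∪ {w′}.
  module _ {D D′ w w′ v} (sD : IsSub n k D) (sD′ : IsSub n k D′) (w∈D : w ∈ D) (w∉D′ : w ∉ D′)
    (D′⊆ : ∀ {z} → z ∈ D′ → z ≡ w′ ⊎ z ∈ D) (v∈ : v ∈ complement D) (v∈′ : v ∈ complement D′)
    (starts : StartsPlus D) (ends : EndsPlus D′) (v+ : entry D v ≡ plus) (v+′ : entry D′ v ≡ plus) where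

    private
      swap : ∀ z → Dec (z ≡ w′) → ℕ
      swap z (yes _) = v
      swap z (no _)  = z

      glue : ∀ z → Dec (z ≤ v) → List ℕ
      glue z (yes _) = insert z D
      glue z (no _)  = insert (swap z (z ≟ w′)) D′

      swap-∈ : ∀ {z} → z ∈ complement D → (d : Dec (z ≡ w′)) → swap z d ∈ complement D′
      swap-∈ z∈ (yes _)   = v∈′
      swap-∈ z∈ (no z≢w′) = ∈-complement-other z∈ λ z∈D′ →
        [ z≢w′ , proj₁ (∈-complement⁻ z∈) ]′ (D′⊆ z∈D′)

      v≤swap : ∀ {z} → ¬ z ≤ v → (d : Dec (z ≡ w′)) → v ≤ swap z d
      v≤swap _   (yes _) = ≤-refl
      v≤swap z≰v (no _)  = <⇒≤ (≰⇒> z≰v)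

      w≢swap : ∀ {z} → z ∈ complement D → (d : Dec (z ≡ w′)) → w ≢ swap z d
      w≢swap _  (yes _) refl = proj₁ (∈-complement⁻ v∈) w∈D
      w≢swap z∈ (no _)  refl = proj₁ (∈-complement⁻ z∈) w∈D

      swap-injective : ∀ {z₁ z₂} → ¬ z₁ ≤ v → ¬ z₂ ≤ v → (d₁ : Dec (z₁ ≡ w′)) (d₂ : Dec (z₂ ≡ w′)) →
                       swap z₁ d₁ ≡ swap z₂ d₂ → z₁ ≡ z₂
      swap-injective _    _    (yes z₁≡w′) (yes z₂≡w′) _    = trans z₁≡w′ (sym z₂≡w′)
      swap-injective _    z₂≰v (yes _)     (no _)      refl = contradiction ≤-refl z₂≰v
      swap-injective z₁≰v _    (no _)      (yes _)     refl = contradiction ≤-refl z₁≰v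
      swap-injective _    _    (no _)      (no _)      eq   = eq

      glue-plus : ∀ {z} → z ∈ complement D → (d : Dec (z ≤ v)) → PlusSubset (glue z d)
      glue-plus z∈ (yes z≤v) = IsSub-insert sD z∈ , starts-extend sD starts v∈ v+ z∈ z≤v
      glue-plus {z} z∈ (no z≰v) =
        IsSub-insert sD′ (swap-∈ z∈ (z ≟ w′)) ,
        ends-extend sD′ ends v∈′ v+′ (swap-∈ z∈ (z ≟ w′)) (v≤swap z≰v (z ≟ w′))

      w∈glue : ∀ {z} (z≤v : z ≤ v) → w ∈ glue z (yes z≤v)
      w∈glue {z} _ = ∈-insert⁺ʳ z w∈D

      w∉glue : ∀ {z} → z ∈ complement D → (z≰v : ¬ z ≤ v) → w ∉ glue z (no z≰v)
      w∉glue {z} z∈ _ = ∉-insert (w≢swap z∈ (z ≟ w′)) w∉D′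

      glue-injective : ∀ {z₁ z₂} → z₁ ∈ complement D → z₂ ∈ complement D →
                       (d₁ : Dec (z₁ ≤ v)) (d₂ : Dec (z₂ ≤ v)) → glue z₁ d₁ ≡ glue z₂ d₂ → z₁ ≡ z₂
      glue-injective z₁∈ _ (yes _) (yes _) eq = insert-injective (proj₁ (∈-complement⁻ z₁∈)) eq
      glue-injective _ z₂∈ (yes z₁≤v) (no z₂≰v) eq =
        contradiction (subst (w ∈_) eq (w∈glue z₁≤v)) (w∉glue z₂∈ z₂≰v)
      glue-injective z₁∈ _ (no z₁≰v) (yes z₂≤v) eq =
        contradiction (subst (w ∈_) (sym eq) (w∈glue z₂≤v)) (w∉glue z₁∈ z₁≰v)
      glue-injective {z₁} {z₂} z₁∈ _ (no z₁≰v) (no z₂≰v) eq =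
        swap-injective z₁≰v z₂≰v (z₁ ≟ w′) (z₂ ≟ w′)
          (insert-injective (proj₁ (∈-complement⁻ (swap-∈ z₁∈ (z₁ ≟ w′)))) eq)

    no-opposite-rows : ⊥
    no-opposite-rows = too-many-plus unique all+ n≤
      where
      glued : List (List ℕ)
      glued = map (λ z → glue z (z ≤? v)) (complement D)
      unique : Unique glued
      unique = map-unique-on _ (λ {z₁} {z₂} z₁∈ z₂∈ → glue-injective z₁∈ z₂∈ (z₁ ≤? v) (z₂ ≤? v))
                             (increasing⇒unique (complement-increasing D))
      all+ : ∀ {R} → R ∈ glued → PlusSubset R
      all+ R∈ = let (z , z∈ , R≡) = ∈-map⁻ _ R∈ in subst PlusSubset (sym R≡) (glue-plus z∈ (z ≤? v))
      n≤ : n ≤ length glued + k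
      n≤ = subst (λ m → n ≤ m + k) (sym (List.length-map _ (complement D))) (length-complement sD)

  starts-at-min : ∀ {D z} → IsSub n k D → z ∈ complement D → entry D z ≡ plus →
                  (∀ {x} → x ∈ complement D → z ≤ x) → StartsPlus D
  starts-at-min {D} sD z∈ z+ z≤ = begin
    head (signs D)                                          ≡⟨ cong head signs≡ ⟩
    head (map (entry D) left ++ plus ∷ map (entry D) right)
      ≡⟨ cong (λ L → head (map (entry D) L ++ plus ∷ map (entry D) right)) left≡[] ⟩
    just plus                                               ∎
    where
    open Around (around sD z∈ z+)
    open ≡-Reasoning
    left≡[] : left ≡ []
    left≡[] = no-member⇒[] λ x∈ → <⇒≱ (All.lookup left<z x∈) (z≤ (left⊆ x∈))

  ends-at-max : ∀ {D z} → IsSub n k D → z ∈ complement D → entry D z ≡ plus →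
                (∀ {x} → x ∈ complement D → x ≤ z) → EndsPlus D
  ends-at-max {D} sD z∈ z+ ≤z = begin
    last (signs D)                                          ≡⟨ cong last signs≡ ⟩
    last (map (entry D) left ++ plus ∷ map (entry D) right)
      ≡⟨ cong (λ L → last (map (entry D) left ++ plus ∷ map (entry D) L)) right≡[] ⟩
    last (map (entry D) left ++ plus ∷ [])                  ≡⟨ last-++ (map (entry D) left) plus [] ⟩
    just plus                                               ∎
    where
    open Around (around sD z∈ z+)
    open ≡-Reasoning
    right≡[] : right ≡ []
    right≡[] = no-member⇒[] λ x∈ → <⇒≱ (All.lookup z<right x∈) (≤z (right⊆ x∈))

  row-through : ∀ {R r} → PlusSubset R → r ∈ R →
                IsSub n k (R ∖ r) × r ∈ complement (R ∖ r) × entry (R ∖ r) r ≡ plus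
  row-through {R} {r} (sR , R+) r∈R =
    IsSub-∖ sR r∈R , ∈-complement-IsSub sR r∈R (∉-∖ R r) , trans (cong τ (insert-∖ (proj₁ sR) r∈R)) R+

  module Exchange {A a} (sA : IsSub n k A) (a∈A : a ∈ A) where

    a≢ : ∀ {x} → x ∈ complement A → a ≢ x
    a≢ x∈ refl = proj₁ (∈-complement⁻ x∈) a∈A

    IsSub-exchange : ∀ {x} → x ∈ complement A → IsSub n k (A [ a ↦ x ])
    IsSub-exchange = IsSub-↦ sA a∈A

    a∈complement : ∀ {x} → x ∈ complement A → a ∈ complement (A [ a ↦ x ])
    a∈complement x∈ = ∈-complement-IsSub sA a∈A (∉-insert (a≢ x∈) (∉-∖ A a))

    ∈-complement-exchange : ∀ {x y} → y ∈ complement A → y ≢ x → y ∈ complement (A [ a ↦ x ])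
    ∈-complement-exchange y∈ y≢x =
      ∈-complement-other y∈ (∉-insert y≢x (proj₁ (∈-complement⁻ y∈) ∘ proj₁ ∘ ∈-∖⁻ A a))

    entry-exchange : ∀ {x} → x ∈ complement A → entry A x ≡ plus → entry (A [ a ↦ x ]) a ≡ plus
    entry-exchange x∈ x+ = trans (cong τ (insert-↦ (proj₁ sA) a∈A (proj₁ (∈-complement⁻ x∈)) (a≢ x∈))) x+

    starts-transfer : ∀ {x y} → x ∈ complement A → y ∈ complement A → x ≢ y →
                      entry A x ≡ plus → entry A y ≡ plus → StartsPlus (A [ a ↦ x ]) → StartsPlus (A [ a ↦ y ])
    starts-transfer {x} {y} x∈ y∈ x≢y x+ y+ starts
      with starts⊎ends (IsSub-exchange y∈) (a∈complement y∈) (entry-exchange y∈ y+)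
    ... | inj₁ starts′ = starts′
    ... | inj₂ ends′ = ⊥-elim (no-opposite-rows (IsSub-exchange x∈) (IsSub-exchange y∈) (∈-insert⁺ˡ x (A ∖ a))
            (∉-insert x≢y (proj₁ (∈-complement⁻ x∈) ∘ proj₁ ∘ ∈-∖⁻ A a)) Dy⊆ (a∈complement x∈) (a∈complement y∈)
            starts ends′ (entry-exchange x∈ x+) (entry-exchange y∈ y+))
      where
      Dy⊆ : ∀ {z} → z ∈ A [ a ↦ y ] → z ≡ y ⊎ z ∈ A [ a ↦ x ]
      Dy⊆ z∈ = Sum.map₂ (uncurry (∈-↦⁺ x)) (∈-↦⁻ A a y z∈)

  module Balance (i : ℕ) where

    S : List ℕ
    S = Sndi n (suc k) i

    InComponent : List ℕ → Set
    InComponent = InC n (suc k) τ i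

    -- For r = b_j ∈ R we have R ∖ r = R_j and rank r R = j − 1, so this says that the (τ, R, j)-series
    -- starts with + exactly when j ≤ i.
    Balanced : List ℕ → Set
    Balanced R = ∀ {r} → r ∈ R → StartsPlus (R ∖ r) ⇔ rank r R < i

    module Step {A x y} (sA : IsSub n k A) (x∈ : x ∈ complement A) (y∈ : y ∈ complement A) (x≢y : x ≢ y)
      (x+ : entry A x ≡ plus) (y+ : entry A y ≡ plus) (balanced : Balanced (insert x A)) where

      private
        module Ex {a} (a∈A : a ∈ A) = Exchange sA a∈A
        lA = proj₁ sA
        x∉A = proj₁ (∈-complement⁻ x∈)
        y∉A = proj₁ (∈-complement⁻ y∈)

        subst-<i⇔ : ∀ {ρ ρ′ σ σ′} → ρ ≡ σ → ρ′ ≡ σ′ → σ < i ⇔ σ′ < i → ρ < i ⇔ ρ′ < i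
        subst-<i⇔ refl refl eqv = eqv

      at-x : StartsPlus A ⇔ rank x A < i
      at-x = subst₂ (λ D ρ → StartsPlus D ⇔ ρ < i) (insert-∖-self lA x∉A) (rank-insert-self x A)
               (balanced (∈-insert⁺ˡ x A))

      at-a : ∀ {a} → a ∈ A → StartsPlus (A [ a ↦ x ]) ⇔ rank a (x ∷ A) < i
      at-a {a} a∈A = subst₂ (λ D ρ → StartsPlus D ⇔ ρ < i) (∖-insert lA x∉A (Ex.a≢ a∈A x∈)) (rank-insert a x A)
                       (balanced (∈-insert⁺ʳ x a∈A))

      no-pivot-up : ∀ {a} → a ∈ A → x < a → a < y → suc (rank a A) ≢ i
      no-pivot-up {a} a∈A x<a a<y sr≡i =
        no-opposite-rows sA sDx a∈A (∉-insert (a≢ x∈) (∉-∖ A a)) (Sum.map₂ proj₁ ∘ ∈-↦⁻ A a x)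
          y∈ y∈Dx startsA endsDx y+ y+Dx
        where
        open Ex a∈A
        sDx = IsSub-exchange x∈
        y∈Dx = ∈-complement-exchange y∈ (x≢y ∘ sym)
        startsA : StartsPlus A
        startsA = Equivalence.from at-x (<-≤-trans (s≤s (rank-mono (<⇒≤ x<a) A)) (≤-reflexive sr≡i))
        endsDx : EndsPlus (A [ a ↦ x ])
        endsDx = ¬starts⇒ends sDx (a∈complement x∈) (entry-exchange x∈ x+)
                   (λ starts → <-irrefl (trans (rank-∷-< A x<a) sr≡i) (Equivalence.to (at-a a∈A) starts))
        y+Dx : entry (A [ a ↦ x ]) y ≡ plus
        y+Dx = ends-extend sDx endsDx (a∈complement x∈) (entry-exchange x∈ x+) y∈Dx (<⇒≤ a<y)

      no-pivot-down : ∀ {a} → a ∈ A → y < a → a < x → suc (rank a A) ≢ i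
      no-pivot-down {a} a∈A y<a a<x sr≡i =
        no-opposite-rows sDx sA (∈-insert⁺ˡ x (A ∖ a)) x∉A A⊆ y∈Dx y∈ startsDx endsA y+Dx y+
        where
        open Ex a∈A
        sDx = IsSub-exchange x∈
        y∈Dx = ∈-complement-exchange y∈ (x≢y ∘ sym)
        endsA : EndsPlus A
        endsA = ¬starts⇒ends sA x∈ x+ λ starts →
          <⇒≱ (Equivalence.to at-x starts) (subst (_≤ rank x A) sr≡i (rank-strict a∈A a<x))
        startsDx : StartsPlus (A [ a ↦ x ])
        startsDx = Equivalence.from (at-a a∈A)
          (subst (_< i) (sym (rank-∷-≮ A (<⇒≯ a<x))) (<-≤-trans (n<1+n _) (≤-reflexive sr≡i)))
        y+Dx : entry (A [ a ↦ x ]) y ≡ plus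
        y+Dx = starts-extend sDx startsDx (a∈complement x∈) (entry-exchange x∈ x+) y∈Dx (<⇒≤ y<a)
        A⊆ : ∀ {z} → z ∈ A → z ≡ a ⊎ z ∈ A [ a ↦ x ]
        A⊆ {z} z∈A with z ≟ a
        ... | yes z≡a = inj₁ z≡a
        ... | no z≢a  = inj₂ (∈-↦⁺ x z∈A z≢a)

      at-y : StartsPlus A ⇔ rank y A < i
      at-y = mk⇔ to from
        where
        to : StartsPlus A → rank y A < i
        to starts with rank y A <? i
        ... | yes ry<i = ry<i
        ... | no ry≮i
          with a , a∈A , x≤a , a<y , sr≡i ← rank-crossing lA (Equivalence.to at-x starts) (≮⇒≥ ry≮i) =
          ⊥-elim (no-pivot-up a∈A (≤∧≢⇒< x≤a λ { refl → x∉A a∈A }) a<y sr≡i)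
        from : rank y A < i → StartsPlus A
        from ry<i with starts⊎ends sA x∈ x+
        ... | inj₁ starts = starts
        ... | inj₂ ends
          with a , a∈A , y≤a , a<x , sr≡i ←
                 rank-crossing lA ry<i (≮⇒≥ (ends⇒¬starts sA x∈ ends ∘ Equivalence.from at-x)) =
          ⊥-elim (no-pivot-down a∈A (≤∧≢⇒< y≤a λ { refl → y∉A a∈A }) a<x sr≡i)

      rank-transfer : ∀ {a} → a ∈ A → rank a (x ∷ A) < i ⇔ rank a (y ∷ A) < i
      rank-transfer {a} a∈A with x <? a | y <? a
      ... | yes x<a | yes y<a = subst-<i⇔ (rank-∷-< A x<a) (rank-∷-< A y<a) (⇔-id _)
      ... | no x≮a  | no y≮a  = subst-<i⇔ (rank-∷-≮ A x≮a) (rank-∷-≮ A y≮a) (⇔-id _)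
      ... | yes x<a | no y≮a  = subst-<i⇔ (rank-∷-< A x<a) (rank-∷-≮ A y≮a)
        (suc<⇔< (no-pivot-up a∈A x<a (≤∧≢⇒< (≮⇒≥ y≮a) λ { refl → y∉A a∈A })))
      ... | no x≮a  | yes y<a = subst-<i⇔ (rank-∷-≮ A x≮a) (rank-∷-< A y<a)
        (⇔-sym (suc<⇔< (no-pivot-down a∈A y<a (≤∧≢⇒< (≮⇒≥ x≮a) λ { refl → x∉A a∈A }))))

      at-a′ : ∀ {a} → a ∈ A → StartsPlus (A [ a ↦ y ]) ⇔ rank a (y ∷ A) < i
      at-a′ {a} a∈A = rank-transfer a∈A ⇔-∘ (at-a a∈A ⇔-∘ rows-agree)
        where
        open Ex a∈A
        rows-agree : StartsPlus (A [ a ↦ y ]) ⇔ StartsPlus (A [ a ↦ x ])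
        rows-agree = mk⇔ (starts-transfer y∈ x∈ (x≢y ∘ sym) y+ x+) (starts-transfer x∈ y∈ x≢y x+ y+)

      balanced-y : Balanced (insert y A)
      balanced-y {r} r∈U with ∈-insert⁻ y A r∈U
      ... | inj₁ refl = subst₂ (λ D ρ → StartsPlus D ⇔ ρ < i)
                          (sym (insert-∖-self lA y∉A)) (sym (rank-insert-self y A)) at-y
      ... | inj₂ r∈A  = subst₂ (λ D ρ → StartsPlus D ⇔ ρ < i)
                          (sym (∖-insert lA y∉A (Ex.a≢ r∈A y∈))) (sym (rank-insert r y A)) (at-a′ r∈A)

    S-balanced : IsSub n (suc k) S → τ S ≡ plus → Balanced S
    S-balanced sS S+ {r} r∈S with row-through (sS , S+) r∈S | ∈-Sndi⁻ n (suc k) i r∈S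
    ... | sD , r∈D , r+ | inj₁ (1≤r , r≤i) =
      mk⇔ (λ _ → <-≤-trans rank<r r≤i) (λ _ → starts-at-min sD r∈D r+ r≤)
      where
      rank<r : rank r S < r
      rank<r = rank<self (proj₁ sS) (All.map proj₁ (proj₁ (proj₂ sS))) 1≤r
      r≤ : ∀ {x} → x ∈ complement (S ∖ r) → r ≤ x
      r≤ x∈ with x∉D , 1≤x , _ ← ∈-complement⁻ x∈ =
        ≮⇒≥ λ x<r → x∉D (∈-∖⁺ r (∈-Sndi⁺ˡ n (suc k) 1≤x (≤-trans (<⇒≤ x<r) r≤i)) (<⇒≢ x<r))
    ... | sD , r∈D , r+ | inj₂ (t≤r , r≤n) =
      mk⇔ (λ starts → ⊥-elim (ends⇒¬starts sD r∈D ends starts)) (λ r<i → ⊥-elim (<⇒≱ r<i i≤rank))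
      where
      ≤r : ∀ {x} → x ∈ complement (S ∖ r) → x ≤ r
      ≤r x∈ with x∉D , _ , x≤n ← ∈-complement⁻ x∈ =
        ≮⇒≥ λ r<x → x∉D (∈-∖⁺ r (∈-Sndi⁺ʳ n (suc k) i (≤-trans t≤r (<⇒≤ r<x)) x≤n) (<⇒≢ r<x ∘ sym))
      ends : EndsPlus (S ∖ r)
      ends = ends-at-max sD r∈D r+ ≤r
      i<r : i < r
      i<r = <-≤-trans (subst (i <_) (+-comm 1 (n ∸ suc k + i)) (s≤s (m≤n+m i (n ∸ suc k)))) t≤r
      i≤rank : i ≤ rank r S
      i≤rank = subst (_≤ rank r S) (length-range 1 i)
        (unique-⊆⇒length≤ (increasing⇒unique (range-increasing 1 i)) λ v∈ →
          let (1≤v , v≤i) = ∈-range⁻ v∈ in ∈-filter⁺ (_<? r) (∈-Sndi⁺ˡ n (suc k) 1≤v v≤i) (≤-<-trans v≤i i<r))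

    reach⇒balanced : ∀ {R} → InComponent R → PlusSubset R × Balanced R
    reach⇒balanced (here sS S+) = (sS , S+) , S-balanced sS S+
    reach⇒balanced (step reach adj sU U+)
      with (sT , T+) , balanced ← reach⇒balanced reach | D , x , y , sD , x∈ , y∈ , refl , refl ← adjacent-rows adj
      with x ≟ y
    ... | yes refl = (sU , U+) , balanced
    ... | no x≢y   = (sU , U+) , Step.balanced-y sD x∈ y∈ x≢y T+ U+ balanced

    module Bounds (c : ℕ) (component-size : HasSize InComponent c) where

      component-bound : ∀ {D Zs} → Unique Zs → (∀ {z} → z ∈ Zs → z ∈ complement D) →
                        (∀ {z} → z ∈ Zs → InComponent (insert z D)) → length Zs ≤ c
      component-bound {D} {Zs} u Zs⊆ Zs-in =
        subst (_≤ c) (List.length-map ins Zs) (HasSize-bound component-size unique all-in)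
        where
        ins = λ z → insert z D
        unique : Unique (map ins Zs)
        unique = map-unique-on ins (λ z∈ _ → insert-injective (proj₁ (∈-complement⁻ (Zs⊆ z∈)))) u
        all-in : ∀ {R} → R ∈ map ins Zs → InComponent R
        all-in R∈ = let (z , z∈ , R≡) = ∈-map⁻ ins R∈ in subst InComponent (sym R≡) (Zs-in z∈)

      module Pivot {R r} (R∈C : InComponent R) (r∈R : r ∈ R) where

        D : List ℕ
        D = R ∖ r

        ins : ℕ → List ℕ
        ins x = insert x D

        R+ : PlusSubset R
        R+ = proj₁ (reach⇒balanced R∈C)

        balanced-at-r : StartsPlus D ⇔ rank r R < i
        balanced-at-r = proj₂ (reach⇒balanced R∈C) r∈R

        sD : IsSub n k D
        sD = proj₁ (row-through R+ r∈R)

        r∈D : r ∈ complement D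
        r∈D = proj₁ (proj₂ (row-through R+ r∈R))

        r+ : entry D r ≡ plus
        r+ = proj₂ (proj₂ (row-through R+ r∈R))

        r-in : InComponent (ins r)
        r-in = subst InComponent (sym (insert-∖ (proj₁ (proj₁ R+)) r∈R)) R∈C

        open Around (around sD r∈D r+) public

        linked : Linked (Adj n (suc k)) (map ins left ++ ins r ∷ map ins right)
        linked = subst (Linked (Adj n (suc k)))
                   (trans (cong (map ins) complement≡) (List.map-++ ins left (r ∷ right)))
                   (row-linked (proj₁ R+) r∈R)

        plus-subsets : ∀ {C} → (∀ {x} → x ∈ C → x ∈ complement D) → All (λ x → entry D x ≡ plus) C →
                       All PlusSubset (map ins C)
        plus-subsets C⊆ C+ = All.map⁺ (All.tabulate λ x∈C → IsSub-insert sD (C⊆ x∈C) , All.lookup C+ x∈C)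

        left-in : StartsPlus D → ∀ {x} → x ∈ complement D → x ≤ r → InComponent (ins x)
        left-in starts x∈ x≤r with m≤n⇒m<n∨m≡n x≤r
        ... | inj₂ refl = r-in
        ... | inj₁ x<r  = All.lookup (All.map⁻ all-in) (∈-left x∈ x<r)
          where
          all-in = spread-left (λ adj Y∈C (sX , X+) → step Y∈C (Adj-sym adj) sX X+) (map ins left) linked r-in
                     (plus-subsets left⊆ (left-plus starts))

        right-in : EndsPlus D → ∀ {x} → x ∈ complement D → r ≤ x → InComponent (ins x)
        right-in ends x∈ r≤x with m≤n⇒m<n∨m≡n r≤x
        ... | inj₂ refl = r-in
        ... | inj₁ r<x  = All.lookup (All.map⁻ all-in) (∈-right x∈ r<x)
          where
          all-in = spread-right (λ adj X∈C (sY , Y+) → step X∈C adj sY Y+) (map ins right)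
                     (linked-suffix (map ins left) linked) r-in (plus-subsets right⊆ (right-plus ends))

        r≤n : r ≤ n
        r≤n = proj₂ (proj₂ (∈-complement⁻ r∈D))

        left-bound : StartsPlus D → r ≤ c + rank r R
        left-bound starts = begin
          r                     ≡⟨ length-range 1 r ⟨
          length (range 1 r)    ≤⟨ unique-cover⇒length≤ (increasing⇒unique (range-increasing 1 r)) cover ⟩
          length Zs + rank r D  ≤⟨ +-monoˡ-≤ (rank r D) (component-bound unique-Zs (proj₁ ∘ ∈-filter⁻ (_≤? r)) Zs-in) ⟩
          c + rank r D          ≡⟨ cong (c +_) (rank-∖-self (proj₁ (proj₁ R+)) r∈R) ⟩
          c + rank r R          ∎
          where
          open ≤-Reasoning
          Zs = filter (_≤? r) (complement D)
          unique-Zs = Unique.filter⁺ (_≤? r) (increasing⇒unique (complement-increasing D))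
          Zs-in : ∀ {z} → z ∈ Zs → InComponent (ins z)
          Zs-in z∈ = uncurry (left-in starts) (∈-filter⁻ (_≤? r) z∈)
          cover : ∀ {v} → v ∈ range 1 r → v ∈ Zs ⊎ v ∈ filter (_<? r) D
          cover {v} v∈ with ∈-range⁻ v∈ | v ∈? D
          ... | _ , v≤r   | yes v∈D =
            inj₂ (∈-filter⁺ (_<? r) v∈D (≤∧≢⇒< v≤r λ { refl → proj₁ (∈-complement⁻ r∈D) v∈D }))
          ... | 1≤v , v≤r | no v∉D  =
            inj₁ (∈-filter⁺ (_≤? r) (∈-complement⁺ v∉D 1≤v (≤-trans v≤r r≤n)) v≤r)

        right-bound : EndsPlus D → suc n ∸ r ≤ c + (k ∸ rank r R)
        right-bound ends = begin
          suc n ∸ r                ≡⟨ length-range r n ⟨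
          length (range r n)       ≤⟨ unique-cover⇒length≤ (increasing⇒unique (range-increasing r n)) cover ⟩
          length Zs + length above ≤⟨ +-mono-≤ (component-bound unique-Zs (proj₁ ∘ ∈-filter⁻ (r ≤?_)) Zs-in)
                                               (≤-reflexive |above|) ⟩
          c + (k ∸ rank r D)       ≡⟨ cong (λ ρ → c + (k ∸ ρ)) (rank-∖-self (proj₁ (proj₁ R+)) r∈R) ⟩
          c + (k ∸ rank r R)       ∎
          where
          open ≤-Reasoning
          Zs = filter (r ≤?_) (complement D)
          above = filter (¬? ∘ (_<? r)) D
          unique-Zs = Unique.filter⁺ (r ≤?_) (increasing⇒unique (complement-increasing D))
          Zs-in : ∀ {z} → z ∈ Zs → InComponent (ins z)
          Zs-in z∈ = uncurry (right-in ends) (∈-filter⁻ (r ≤?_) z∈)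
          |above| : length above ≡ k ∸ rank r D
          |above| = trans (sym (m+n∸m≡n (rank r D) (length above)))
                      (cong (_∸ rank r D) (trans (length-filter+filter-∁ (_<? r) D) (proj₂ (proj₂ sD))))
          cover : ∀ {v} → v ∈ range r n → v ∈ Zs ⊎ v ∈ above
          cover {v} v∈ with ∈-range⁻ v∈ | v ∈? D
          ... | r≤v , _   | yes v∈D = inj₂ (∈-filter⁺ (¬? ∘ (_<? r)) v∈D (≤⇒≯ r≤v))
          ... | r≤v , v≤n | no v∉D  =
            inj₁ (∈-filter⁺ (r ≤?_) (∈-complement⁺ v∉D (≤-trans (proj₁ (proj₂ (∈-complement⁻ r∈D))) r≤v) v≤n) r≤v)

      at-pivot : ∀ {B j} → IsSub n (suc k) B → 1 ≤ j → j ≤ suc k →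
                 at B j ∈ B × suc (rank (at B j) B) ≡ j × series n τ B j ≡ signs (B ∖ at B j)
      at-pivot {B} {suc m} sB@(l , _ , len) 1≤j j≤ with r∈B , removeAt≡ ← at-IsSub sB 1≤j j≤ =
        r∈B , cong suc (rank-at l (subst (m <_) (sym len) j≤)) , cong signs removeAt≡

      left-aligned : ∀ {B j} → InComponent B → 1 ≤ j → j ≤ i → j ≤ suc k →
                     (at B j ≤ c + j ∸ 1) × LeftAligned (series n τ B j)
      left-aligned {B} {j} B∈C 1≤j j≤i j≤d
        with r∈B , rank≡ , series≡ ← at-pivot (proj₁ (proj₁ (reach⇒balanced B∈C))) 1≤j j≤d =
        bound , subst (λ s → head s ≡ just plus) (sym series≡) starts
              , subst (λ s → last s ≡ just minus) (sym series≡) (last-minus (signs D) (plus∈signs r∈D r+) ¬ends)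
        where
        open Pivot B∈C r∈B
        starts : StartsPlus D
        starts = Equivalence.from balanced-at-r (subst (_≤ i) (sym rank≡) j≤i)
        ¬ends : ¬ EndsPlus D
        ¬ends ends = ¬starts×ends sD r∈D (starts , ends)
        bound : at B j ≤ c + j ∸ 1
        bound = subst (λ ρ → at B j ≤ ρ ∸ 1) (trans (sym (+-suc c _)) (cong (c +_) rank≡)) (left-bound starts)

      right-aligned : ∀ {B j} → InComponent B → i + 1 ≤ j → j ≤ suc k →
                      (n ∸ (c + suc k ∸ j) + 1 ≤ at B j) × RightAligned (series n τ B j)
      right-aligned {B} {j} B∈C i+1≤j j≤d
        with r∈B , rank≡ , series≡ ← at-pivot (proj₁ (proj₁ (reach⇒balanced B∈C))) (≤-trans (m≤n+m 1 i) i+1≤j) j≤d =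
        bound , subst (λ s → head s ≡ just minus) (sym series≡) (head-minus (signs D) (plus∈signs r∈D r+) ¬starts)
              , subst (λ s → last s ≡ just plus) (sym series≡) ends
        where
        open Pivot B∈C r∈B
        m = rank (at B j) B
        ¬starts : ¬ StartsPlus D
        ¬starts starts =
          <⇒≱ (Equivalence.to balanced-at-r starts) (s≤s⁻¹ (subst₂ _≤_ (+-comm i 1) (sym rank≡) i+1≤j))
        ends : EndsPlus D
        ends = ¬starts⇒ends sD r∈D r+ ¬starts
        c+d∸j≡ : c + suc k ∸ j ≡ c + (k ∸ m)
        c+d∸j≡ = begin
          c + suc k ∸ j      ≡⟨ cong (c + suc k ∸_) rank≡ ⟨
          c + suc k ∸ suc m  ≡⟨ cong (_∸ suc m) (+-suc c k) ⟩
          c + k ∸ m          ≡⟨ +-∸-assoc c (s≤s⁻¹ (subst (_≤ suc k) (sym rank≡) j≤d)) ⟩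
          c + (k ∸ m)        ∎
          where open ≡-Reasoning
        bound : n ∸ (c + suc k ∸ j) + 1 ≤ at B j
        bound = subst (λ K → n ∸ K + 1 ≤ at B j) (sym c+d∸j≡)
                  (m∸n+1≤o (proj₁ (proj₂ (∈-complement⁻ r∈D))) (right-bound ends))

lemma10 : (n d c p i : ℕ) → d < n → 1 ≤ c → c ≤ p → p ≤ n ∸ d → i ≤ d →
    (τ : List ℕ → Sign) → InSbar p n d τ →
    HasSize (InC n d τ i) c →
    (B : List ℕ) → InC n d τ i B →
    ((j : ℕ) → 1 ≤ j → j ≤ i →
      (at B j ≤ c + j ∸ 1) × LeftAligned (series n τ B j)) ×
    ((j : ℕ) → i + 1 ≤ j → j ≤ d →
      (n ∸ (c + d ∸ j) + 1 ≤ at B j) × RightAligned (series n τ B j))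
lemma10 n zero c p i _ _ _ _ i≤d _ _ _ _ _ =
  (λ j 1≤j j≤i → contradiction (≤-trans 1≤j (≤-trans j≤i i≤d)) λ ()) ,
  (λ j i+1≤j j≤0 → contradiction (≤-trans (m≤n+m 1 i) (≤-trans i+1≤j j≤0)) λ ())
lemma10 n (suc k) c p i d<n _ _ p≤n∸d i≤d τ (τ-cosignotope , plus-size) component-size B B∈C =
  (λ j 1≤j j≤i → left-aligned B∈C 1≤j j≤i (≤-trans j≤i i≤d)) ,
  (λ j i+1≤j j≤d → right-aligned B∈C i+1≤j j≤d)
  where
  p+k<n : p + k < n
  p+k<n = subst (_≤ n) (+-suc p k) (m≤o∸n⇒m+n≤o p (<⇒≤ d<n) p≤n∸d)
  open RowSigns n k p τ τ-cosignotope plus-size p+k<n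
  open Balance i
  open Bounds c component-size
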